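{- Let $G=\langle\{r,r'\},V,E,v_0,L,\{B_1,B_2\}\rangle$ be a colored Büchi graph of degree two. Then there exists a Büchi graph $G'$ whose size satisfies $|G'|\in\mathcal{O}(|G|^2)$ such that $G$ has a pumpable accepting path if, and only if, $G'$ has an accepting path.
   Context: A colored Büchi graph of degree two is a tuple $G=\langle\{r,r'\},V,E,v_0,L,\{B_1,B_2\}\rangle$ where $r,r'$ are propositions, $V$ is a set of vertices, $E\subseteq V\times V$ is a set of edges, $v_0\in V$ is the initial vertex, $L:V\to 2^{\{r,r'\}}$ is a coloring, and $B_1,B_2\subseteq V$. A Büchi graph is such a structure without the coloring $L$ (a tuple of vertices, edges, initial vertex and a generalized Büchi condition). A path is an infinite sequence $\pi=v_0v_1v_2\cdots$ starting in the initial vertex with $(v_i,v_{i+1})\in E$ for all $i$; it is accepting if it visits both $B_1$ and $B_2$ infinitely often. A position $i$ of $\pi$ is an $r'$-change point if $i=0$ or the truth value of $r'$ in $L(v_i)$ differs from that in $L(v_{i-1})$; two change points $i<i'$ are adjacent if there is no change point strictly between them. The path $\pi$ is pumpable if for all adjacent $r'$-change points $i<i'$ there are positions $j,j',j''$ with $i\le j<j'<j''<i'$, $v_j=v_{j''}$, and $r\in L(v_j)$ iff $r\notin L(v_{j'})$. The size of a graph is measured by its number of vertices and edges. -}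

module Defs where

open import Data.Nat using (ℕ; zero; suc; _+_; _≤_; _<_)
open import Data.Bool using (Bool; true; false; if_then_else_)
open import Data.Fin using (Fin)
open import Data.List using (List; map; allFin)
open import Data.Nat.ListAction using (sum)
open import Data.Product using (Σ; _×_; ∃; ∃-syntax)
open import Data.Sum using (_⊎_)
open import Relation.Binary.PropositionalEquality using (_≡_; _≢_)
open import Relation.Nullary using (¬_)

record BuchiGraph : Set where
  field
    n  : ℕ
    E  : Fin n → Fin n → Bool
    v₀ : Fin n
    B₁ : Fin n → Bool
    B₂ : Fin n → Bool

-- Colored Büchi graph of degree two: the coloring L : V → 2^{r,r'} is given by
-- its two components: r ∈ L(v) iff Lr v ≡ true, r' ∈ L(v) iff Lr' v ≡ true.
record ColoredBuchiGraph : Set where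
  field
    graph : BuchiGraph
  open BuchiGraph graph public
  field
    Lr  : Fin n → Bool
    Lr' : Fin n → Bool

edgeCount : (n : ℕ) → (Fin n → Fin n → Bool) → ℕ
edgeCount n E = sum (map (λ u → sum (map (λ v → if E u v then 1 else 0) (allFin n))) (allFin n))

size : BuchiGraph → ℕ
size G = BuchiGraph.n G + edgeCount (BuchiGraph.n G) (BuchiGraph.E G)

csize : ColoredBuchiGraph → ℕ
csize G = size (ColoredBuchiGraph.graph G)

IsPath : (G : BuchiGraph) → (ℕ → Fin (BuchiGraph.n G)) → Set
IsPath G π = (π 0 ≡ BuchiGraph.v₀ G) × (∀ i → BuchiGraph.E G (π i) (π (suc i)) ≡ true)

InfOften : {n : ℕ} → (Fin n → Bool) → (ℕ → Fin n) → Set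
InfOften B π = ∀ k → ∃[ i ] (k ≤ i × B (π i) ≡ true)

IsAccepting : (G : BuchiGraph) → (ℕ → Fin (BuchiGraph.n G)) → Set
IsAccepting G π = InfOften (BuchiGraph.B₁ G) π × InfOften (BuchiGraph.B₂ G) π

HasAcceptingPath : BuchiGraph → Set
HasAcceptingPath G = ∃[ π ] (IsPath G π × IsAccepting G π)

module _ (G : ColoredBuchiGraph) where
  open ColoredBuchiGraph G

  ChangePoint : (ℕ → Fin n) → ℕ → Set
  ChangePoint π zero    = Data.Unit.⊤ where import Data.Unit
  ChangePoint π (suc i) = Lr' (π (suc i)) ≢ Lr' (π i)

  Adjacent : (ℕ → Fin n) → ℕ → ℕ → Set
  Adjacent π i i' = i < i' × ChangePoint π i × ChangePoint π i'
                    × (∀ k → i < k → k < i' → ¬ ChangePoint π k)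

  Pumpable : (ℕ → Fin n) → Set
  Pumpable π = ∀ i i' → Adjacent π i i' →
    ∃[ j ] ∃[ j' ] ∃[ j'' ]
      (i ≤ j × j < j' × j' < j'' × j'' < i'
       × π j ≡ π j''
       × Lr (π j) ≢ Lr (π j'))

  HasPumpableAcceptingPath : Set
  HasPumpableAcceptingPath =
    ∃[ π ] (IsPath graph π × IsAccepting graph π × Pumpable π)

module Submission where

-- Call w good if a closed walk through w that stays inside the r'-class of w
-- visits a vertex of the other r-value.  Goodness is decidable, because
-- reachability in a finite graph is (module Walks: loop erasure bounds walks by
-- the number of vertices).  G′ runs on V × Bool, the flag recording whether the
-- current r'-block has visited a good vertex; an r'-change is only allowed out
-- of a block whose flag is set.
--   ⇒ A pumpable path visits, in each block it leaves, the vertex j of a pumping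
--     triple j < j′ < j″, which is good; so the flags along the path permit it.
--   ⇐ An accepting path of G′ has a good vertex in each block it leaves; splicing
--     the witnessing cycle after every good vertex (module Splice) yields a path
--     of G that is pumpable and visits B₁, B₂ as often as the original.

open import Defs
open import Level using (0ℓ)
open import Function using (_∘_; id)
open import Function.Bundles using (_⇔_; mk⇔)
open import Data.Empty using (⊥-elim)
open import Data.Product using (∃-syntax; _×_; _,_; proj₁; proj₂)
open import Data.Sum using (_⊎_; inj₁; inj₂; [_,_]′)
open import Data.Bool using (Bool; true; false; _∨_; if_then_else_)
import Data.Bool.Properties as Bool
open import Data.Nat using (ℕ; zero; suc; _+_; _*_; _^_; _≤_; _<_; z≤n; s≤s; >-nonZero)
import Data.Nat as ℕ
open import Data.Nat.Properties
open import Data.Nat.ListAction using (sum)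
open import Data.Nat.Tactic.RingSolver using (solve-∀)
open import Data.Fin using (Fin; zero; suc; splitAt; _↑ˡ_; _↑ʳ_)
import Data.Fin.Properties as Fin
open import Data.List using (List; []; _∷_; _++_; length; lookup; map; allFin)
open import Data.List.Properties using (length-tabulate)
open import Data.List.Membership.Propositional using (_∈_)
open import Data.List.Membership.Propositional.Properties using (∈-lookup; ∈-++⁺ˡ)
open import Data.List.Relation.Unary.Any using (here; there)
import Data.List.Relation.Unary.All as All
open import Data.List.Relation.Unary.All.Properties using (¬Any⇒All¬)
open import Data.List.Relation.Unary.AllPairs using ([]; _∷_)
open import Data.List.Relation.Unary.Unique.Propositional using (Unique)
open import Relation.Nullary using (¬_; Dec; yes; no; does; ¬?)
open import Relation.Nullary.Decidable using (decidable-stable; dec-true; _×-dec_; _⊎-dec_; map′)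
open import Relation.Unary using (Pred; Decidable)
open import Relation.Binary.PropositionalEquality using (_≡_; _≢_; refl; sym; trans; cong; subst; subst₂)

does⇒ : ∀ {A : Set} (a? : Dec A) → does a? ≡ true → A
does⇒ (yes a) _  = a
does⇒ (no _)  ()

∨-true : ∀ f {g} → f ∨ g ≡ true → f ≡ true ⊎ g ≡ true
∨-true true  _   = inj₁ refl
∨-true false g≡t = inj₂ g≡t

infOften-map : ∀ {m k} {π : ℕ → Fin m} {π′ : ℕ → Fin k} (B : Fin m → Bool) (f : Fin k → Fin m) →
               (∀ t → f (π′ t) ≡ π t) → InfOften B π → InfOften (B ∘ f) π′
infOften-map B f onto inf k with inf k
... | i , k≤i , Bπi = i , k≤i , trans (cong B (onto i)) Bπi

-- A duplicate-free list of vertices is no longer than the number of vertices: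
-- looking up its entries is an injection Fin (length xs) → Fin n.
unique-length : ∀ {n} {xs : List (Fin n)} → Unique xs → length xs ≤ n
unique-length uq = Fin.injective⇒≤ (lookup-injective uq _ _)
  where
    lookup-injective : ∀ {n} {xs : List (Fin n)} → Unique xs →
                       ∀ i j → lookup xs i ≡ lookup xs j → i ≡ j
    lookup-injective (_ ∷ _) zero zero _ = refl
    lookup-injective (x∉xs ∷ _) zero (suc j) eq = ⊥-elim (All.lookup x∉xs (∈-lookup j) eq)
    lookup-injective (x∉xs ∷ _) (suc i) zero eq = ⊥-elim (All.lookup x∉xs (∈-lookup i) (sym eq))
    lookup-injective (_ ∷ uq) (suc i) (suc j) eq = cong suc (lookup-injective uq i j eq)

module Walks {n : ℕ} (E : Fin n → Fin n → Bool) where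

  open import Data.List.Membership.DecPropositional (Fin._≟_ {n}) using (_∈?_)

  -- A walk from u to v along edges of E; xs lists the vertices after u,
  -- each of which satisfies the constraint P.
  data Walk (P : Pred (Fin n) 0ℓ) : Fin n → List (Fin n) → Fin n → Set where
    nil  : ∀ {u} → Walk P u [] u
    cons : ∀ {u x xs v} → E u x ≡ true → P x → Walk P x xs v → Walk P u (x ∷ xs) v

  Reachable : Pred (Fin n) 0ℓ → Fin n → Fin n → Set
  Reachable P u v = ∃[ xs ] Walk P u xs v

  _++ʷ_ : ∀ {P u xs x ys v} → Walk P u xs x → Walk P x ys v → Walk P u (xs ++ ys) v
  nil        ++ʷ w′ = w′
  cons e p w ++ʷ w′ = cons e p (w ++ʷ w′)

  end∈ : ∀ {P u xs v} → Walk P u xs v → u ≢ v → v ∈ xs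
  end∈ nil u≢u = ⊥-elim (u≢u refl)
  end∈ {v = v} (cons {x = x} _ _ w) _ with x Fin.≟ v
  ... | yes refl = here refl
  ... | no x≢v   = there (end∈ w x≢v)

  simplify : ∀ {P u xs v} → Walk P u xs v → ∃[ ys ] (Walk P u ys v × Unique (u ∷ ys))
  simplify nil = [] , nil , All.[] ∷ []
  simplify {u = u} (cons e p w) with simplify w
  ... | ys , w′ , uq with u ∈? (_ ∷ ys)
  ...   | yes u∈ = resume w′ uq u∈
    where
      resume : ∀ {P x zs v y} → Walk P x zs v → Unique (x ∷ zs) → y ∈ x ∷ zs →
               ∃[ ys ] (Walk P y ys v × Unique (y ∷ ys))
      resume w uq (here refl) = _ , w , uq
      resume (cons _ _ w) (_ ∷ uq) (there y∈) = resume w uq y∈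
  ...   | no u∉ = _ , cons e p w′ , ¬Any⇒All¬ _ u∉ ∷ uq

  module _ {P : Pred (Fin n) 0ℓ} (P? : Decidable P) where

    Within : ℕ → Fin n → Fin n → Set
    Within zero    u v = u ≡ v
    Within (suc k) u v = u ≡ v ⊎ ∃[ x ] (E u x ≡ true × P x × Within k x v)

    within? : ∀ k u v → Dec (Within k u v)
    within? zero    u v = u Fin.≟ v
    within? (suc k) u v =
      u Fin.≟ v ⊎-dec Fin.any? (λ x → (E u x Bool.≟ true) ×-dec P? x ×-dec within? k x v)

    within⇒reachable : ∀ k {u v} → Within k u v → Reachable P u v
    within⇒reachable zero    refl = [] , nil
    within⇒reachable (suc k) (inj₁ refl) = [] , nil
    within⇒reachable (suc k) (inj₂ (x , e , p , r)) with within⇒reachable k r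
    ... | xs , w = x ∷ xs , cons e p w

    walk⇒within : ∀ k {u xs v} → Walk P u xs v → length xs ≤ k → Within k u v
    walk⇒within zero    nil _ = refl
    walk⇒within (suc k) nil _ = inj₁ refl
    walk⇒within (suc k) (cons e p w) (s≤s len) = inj₂ (_ , e , p , walk⇒within k w len)

    -- Reachability is decidable: a duplicate-free walk has fewer than n steps.
    reachable? : ∀ u v → Dec (Reachable P u v)
    reachable? u v = map′ (within⇒reachable n) shorten (within? n u v)
      where
        shorten : Reachable P u v → Within n u v
        shorten (_ , w) with simplify w
        ... | ys , w′ , uq = walk⇒within n w′ (<⇒≤ (unique-length uq))

-- Splicing finite detours into an infinite sequence: σ runs through
-- π 0, detour (π 0), π 1, detour (π 1), π 2, ...
module Splice {A : Set} (π : ℕ → A) (detour : A → List A) where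

  -- (t , c , rest): σ is at c inside the block of π t, and rest is still to come.
  State : Set
  State = ℕ × A × List A

  next : State → State
  next (t , _ , [])     = suc t , π (suc t) , detour (π (suc t))
  next (t , _ , x ∷ xs) = t , x , xs

  state : ℕ → State
  state zero    = 0 , π 0 , detour (π 0)
  state (suc p) = next (state p)

  σ : ℕ → A
  σ p = proj₁ (proj₂ (state p))

  block : ℕ → ℕ
  block p = proj₁ (state p)

  block-step : ∀ p → block p ≤ block (suc p) × block (suc p) ≤ suc (block p)
  block-step p with state p
  ... | t , _ , []    = n≤1+n t , ≤-refl
  ... | t , _ , _ ∷ _ = ≤-refl , n≤1+n t

  block-mono : ∀ {p q} → p ≤ q → block p ≤ block q
  block-mono {q = zero} z≤n = ≤-refl
  block-mono {p} {suc q} p≤1+q with m≤n⇒m<n∨m≡n p≤1+q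
  ... | inj₁ p<1+q = ≤-trans (block-mono (≤-pred p<1+q)) (proj₁ (block-step q))
  ... | inj₂ refl  = ≤-refl

  block≤ : ∀ p → block p ≤ p
  block≤ zero    = z≤n
  block≤ (suc p) = ≤-trans (proj₂ (block-step p)) (s≤s (block≤ p))

  finish : ∀ xs {p t c} → state p ≡ (t , c , xs) →
           ∃[ c′ ] (state (length xs + p) ≡ (t , c′ , []))
  finish []       eq = _ , eq
  finish (x ∷ xs) {p} eq with finish xs {suc p} (cong next eq)
  ... | c′ , eq′ = c′ , trans (cong state (sym (+-suc (length xs) p))) eq′

  visit : ∀ xs {p t c x} → state p ≡ (t , c , xs) → x ∈ xs →
          ∃[ m ] (m < length xs × σ (suc m + p) ≡ x)
  visit (x ∷ xs) eq (here refl) = 0 , s≤s z≤n , cong (proj₁ ∘ proj₂) (cong next eq)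
  visit (y ∷ xs) {p} eq (there x∈) with visit xs {suc p} (cong next eq) x∈
  ... | m , m< , σx = suc m , s≤s m< , trans (cong σ (sym (cong suc (+-suc m p)))) σx

  blockStart : ∀ t → ∃[ p ] (state p ≡ (t , π t , detour (π t)))
  blockStart zero = 0 , refl
  blockStart (suc t) with blockStart t
  ... | p , eq with finish (detour (π t)) eq
  ... | _ , eq′ = suc (length (detour (π t)) + p) , cong next eq′

module Construction (G : ColoredBuchiGraph) where
  open ColoredBuchiGraph G
  open Walks E

  -- r'-behaviour of a vertex sequence on the interval from i up to t (t exclusive,
  -- as in Adjacent): no change point after i, resp. constant r'-value.  The two
  -- notions coincide; the pumping argument needs both readings.
  NoChangeIn : (ℕ → Fin n) → ℕ → ℕ → Set
  NoChangeIn π i t = ∀ k → i < k → k < t → ¬ ChangePoint G π k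

  ConstantOn : (ℕ → Fin n) → ℕ → ℕ → Set
  ConstantOn π i t = ∀ m → i ≤ m → m < t → Lr' (π m) ≡ Lr' (π i)

  noChange⇒constant : ∀ {π i t} → NoChangeIn π i t → ConstantOn π i t
  noChange⇒constant nc zero z≤n _ = refl
  noChange⇒constant {π} {i} nc (suc m) i≤1+m 1+m<t with i ℕ.≟ suc m
  ... | yes refl = refl
  ... | no i≢1+m =
    trans (decidable-stable (Lr' (π (suc m)) Bool.≟ Lr' (π m)) (nc (suc m) i<1+m 1+m<t))
          (noChange⇒constant nc m (≤-pred i<1+m) (<-trans (n<1+n m) 1+m<t))
    where
      i<1+m : i < suc m
      i<1+m = ≤∧≢⇒< i≤1+m i≢1+m

  constant⇒noChange : ∀ {π i t} → ConstantOn π i t → NoChangeIn π i t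
  constant⇒noChange same (suc k) i<1+k 1+k<t change =
    change (trans (same (suc k) (<⇒≤ i<1+k) 1+k<t)
                  (sym (same k (≤-pred i<1+k) (<-trans (n<1+n k) 1+k<t))))

  constant-here : ∀ {π} k → ConstantOn π k (suc k)
  constant-here {π} k m k≤m m<1+k = cong (Lr' ∘ π) (≤-antisym (≤-pred m<1+k) k≤m)

  constant-extend : ∀ {π k t} → ConstantOn π k (suc t) → k ≤ t →
                    Lr' (π t) ≡ Lr' (π (suc t)) → ConstantOn π k (suc (suc t))
  constant-extend {t = t} same k≤t step m k≤m m<2+t with m ℕ.≟ suc t
  ... | yes refl = trans (sym step) (same t k≤t ≤-refl)
  ... | no m≢1+t = same m k≤m (≤∧≢⇒< (≤-pred m<2+t) m≢1+t)

  lastChange : ∀ π t → ∃[ i ] (i ≤ t × ChangePoint G π i × NoChangeIn π i (suc t))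
  lastChange π zero = 0 , z≤n , _ , λ k 0<k k<1 _ → <⇒≱ 0<k (≤-pred k<1)
  lastChange π (suc t) with Lr' (π (suc t)) Bool.≟ Lr' (π t)
  ... | no change = suc t , ≤-refl , change , λ k 1+t<k k<2+t _ → <⇒≱ 1+t<k (≤-pred k<2+t)
  ... | yes same with lastChange π t
  ...   | i , i≤t , cp , nc = i , m≤n⇒m≤1+n i≤t , cp , nc′
    where
      nc′ : NoChangeIn π i (suc (suc t))
      nc′ k i<k k<2+t with k ℕ.≟ suc t
      ... | yes refl = λ change → change same
      ... | no k≢1+t = nc k i<k (≤∧≢⇒< (≤-pred k<2+t) k≢1+t)

  SameColor : Fin n → Pred (Fin n) 0ℓ
  SameColor w x = Lr' x ≡ Lr' w

  sameColor? : ∀ w → Decidable (SameColor w)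
  sameColor? w x = Lr' x Bool.≟ Lr' w

  -- w is good if some closed walk through w inside its r'-class visits a
  -- vertex with the other r-value: such a cycle can serve as a pumping witness.
  Good : Fin n → Set
  Good w = ∃[ x ] (Lr x ≢ Lr w × Reachable (SameColor w) w x × Reachable (SameColor w) x w)

  good? : ∀ w → Dec (Good w)
  good? w = Fin.any? λ x → ¬? (Lr x Bool.≟ Lr w)
                      ×-dec reachable? (sameColor? w) w x
                      ×-dec reachable? (sameColor? w) x w

  good : Fin n → Bool
  good w = does (good? w)

  -- The product construction: G′ runs on V × Bool; the flag records whether the
  -- current r'-block has already visited a good vertex, and an r'-change is only
  -- allowed out of a block whose flag is set.
  Step : Fin n × Bool → Fin n × Bool → Set
  Step (v , f) (v′ , f′) = E v v′ ≡ true ×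
    (Lr' v ≡ Lr' v′ × f′ ≡ f ∨ good v′ ⊎ Lr' v ≢ Lr' v′ × f ≡ true × f′ ≡ good v′)

  step? : ∀ p q → Dec (Step p q)
  step? (v , f) (v′ , f′) = E v v′ Bool.≟ true
    ×-dec (Lr' v Bool.≟ Lr' v′ ×-dec f′ Bool.≟ f ∨ good v′
           ⊎-dec ¬? (Lr' v Bool.≟ Lr' v′) ×-dec f Bool.≟ true ×-dec f′ Bool.≟ good v′)

  encode : Fin n × Bool → Fin (n + n)
  encode (v , false) = v ↑ˡ n
  encode (v , true)  = n ↑ʳ v

  decode : Fin (n + n) → Fin n × Bool
  decode a = [ (_, false) , (_, true) ]′ (splitAt n a)

  decode-encode : ∀ p → decode (encode p) ≡ p
  decode-encode (v , false) rewrite Fin.splitAt-↑ˡ n v n = refl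
  decode-encode (v , true)  rewrite Fin.splitAt-↑ʳ n n v = refl

  G′ : BuchiGraph
  G′ = record
    { n  = n + n
    ; E  = λ a b → does (step? (decode a) (decode b))
    ; v₀ = encode (v₀ , good v₀)
    ; B₁ = B₁ ∘ proj₁ ∘ decode
    ; B₂ = B₂ ∘ proj₁ ∘ decode
    }

  module PumpableToAccepting (π : ℕ → Fin n) (path : IsPath graph π) (pump : Pumpable G π) where

    segment : ∀ {P} a b → a ≤ b → (∀ k → a < k → k ≤ b → P (π k)) → Reachable P (π a) (π b)
    segment zero zero z≤n _ = [] , nil
    segment a (suc b) a≤1+b inP with m≤n⇒m<n∨m≡n a≤1+b
    ... | inj₂ refl = [] , nil
    ... | inj₁ a<1+b with segment a b (≤-pred a<1+b) (λ k a<k k≤b → inP k a<k (m≤n⇒m≤1+n k≤b))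
    ...   | xs , w = _ , w ++ʷ cons (proj₂ path b) (inP (suc b) a<1+b ≤-refl) nil

    blockHasGood : ∀ t → Lr' (π t) ≢ Lr' (π (suc t)) →
                   ∃[ j ] (j ≤ t × Good (π j) × NoChangeIn π j (suc t))
    blockHasGood t change with lastChange π t
    ... | i , i≤t , cpᵢ , nc with pump i (suc t) (s≤s i≤t , cpᵢ , change ∘ sym , nc)
    ...   | j , j′ , j″ , i≤j , j<j′ , j′<j″ , j″<1+t , πj≡πj″ , flip =
      j , j≤t , (π j′ , flip ∘ sym , forth , back) , λ k j<k → nc k (≤-<-trans i≤j j<k)
      where
        j≤t : j ≤ t
        j≤t = ≤-pred (<-trans j<j′ (<-trans j′<j″ j″<1+t))
        inBlock : ∀ k → j ≤ k → k ≤ j″ → SameColor (π j) (π k)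
        inBlock k j≤k k≤j″ = trans (noChange⇒constant nc k (≤-trans i≤j j≤k) (≤-<-trans k≤j″ j″<1+t))
                                   (sym (noChange⇒constant nc j i≤j (s≤s j≤t)))
        forth : Reachable (SameColor (π j)) (π j) (π j′)
        forth = segment j j′ (<⇒≤ j<j′) λ k j<k k≤j′ → inBlock k (<⇒≤ j<k) (≤-trans k≤j′ (<⇒≤ j′<j″))
        back : Reachable (SameColor (π j)) (π j′) (π j)
        back = subst (Reachable _ (π j′)) (sym πj≡πj″)
                 (segment j′ j″ (<⇒≤ j′<j″) λ k j′<k k≤j″ → inBlock k (<⇒≤ (<-trans j<j′ j′<k)) k≤j″)

    -- the flag G′ attaches to position t: has the block of t visited a good vertex?
    flag : ℕ → Bool
    flag zero    = good (π 0)
    flag (suc t) with Lr' (π t) Bool.≟ Lr' (π (suc t))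
    ... | yes _ = flag t ∨ good (π (suc t))
    ... | no  _ = good (π (suc t))

    flag-good : ∀ t → good (π t) ≡ true → flag t ≡ true
    flag-good zero    g = g
    flag-good (suc t) g with Lr' (π t) Bool.≟ Lr' (π (suc t))
    ... | yes _ = trans (cong (flag t ∨_) g) (Bool.∨-zeroʳ (flag t))
    ... | no  _ = g

    flag-set : ∀ t k → k ≤ t → Good (π k) → NoChangeIn π k (suc t) → flag t ≡ true
    flag-set t k k≤t g nc with m≤n⇒m<n∨m≡n k≤t
    ... | inj₂ refl = flag-good t (dec-true (good? (π t)) g)
    flag-set (suc t) k _ g nc | inj₁ k<1+t with Lr' (π t) Bool.≟ Lr' (π (suc t))
    ... | yes _ = cong (_∨ good (π (suc t)))
                    (flag-set t k (≤-pred k<1+t) g λ m k<m m<1+t → nc m k<m (m<n⇒m<1+n m<1+t))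
    ... | no change = ⊥-elim (nc (suc t) k<1+t ≤-refl (change ∘ sym))

    step : ∀ t → Step (π t , flag t) (π (suc t) , flag (suc t))
    step t with Lr' (π t) Bool.≟ Lr' (π (suc t))
    ... | yes same  = proj₂ path t , inj₁ (same , refl)
    ... | no change with blockHasGood t change
    ...   | j , j≤t , g , nc = proj₂ path t , inj₂ (change , flag-set t j j≤t g nc , refl)

    lift : IsAccepting graph π → HasAcceptingPath G′
    lift (inf₁ , inf₂) = ρ , (cong (λ v → encode (v , good v)) (proj₁ path) , edge)
                       , infOften-map B₁ (proj₁ ∘ decode) onto inf₁
                       , infOften-map B₂ (proj₁ ∘ decode) onto inf₂
      where
        ρ : ℕ → Fin (n + n)
        ρ t = encode (π t , flag t)
        edge : ∀ t → BuchiGraph.E G′ (ρ t) (ρ (suc t)) ≡ true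
        edge t = dec-true (step? _ _)
          (subst₂ Step (sym (decode-encode _)) (sym (decode-encode _)) (step t))
        onto : ∀ t → proj₁ (decode (ρ t)) ≡ π t
        onto t = cong proj₁ (decode-encode (π t , flag t))

  detourOf : ∀ w → Dec (Good w) → List (Fin n)
  detourOf w (yes (_ , _ , (xs , _) , (ys , _))) = xs ++ ys
  detourOf w (no _) = []

  detour : Fin n → List (Fin n)
  detour w = detourOf w (good? w)

  detourOf-walk : ∀ w d → Walk (SameColor w) w (detourOf w d) w
  detourOf-walk w (yes (_ , _ , (_ , forth) , (_ , back))) = forth ++ʷ back
  detourOf-walk w (no _) = nil

  detourOf-flips : ∀ w d → does d ≡ true → ∃[ x ] (x ∈ detourOf w d × Lr x ≢ Lr w)
  detourOf-flips w (yes (x , flip , (_ , forth) , _)) _ =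
    x , ∈-++⁺ˡ (end∈ forth (flip ∘ cong Lr ∘ sym)) , flip

  module AcceptingToPumpable (ρ : ℕ → Fin (n + n)) (path : IsPath G′ ρ) where

    π : ℕ → Fin n
    π t = proj₁ (decode (ρ t))

    fl : ℕ → Bool
    fl t = proj₂ (decode (ρ t))

    start : decode (ρ 0) ≡ (v₀ , good v₀)
    start = trans (cong decode (proj₁ path)) (decode-encode _)

    step : ∀ t → Step (π t , fl t) (π (suc t) , fl (suc t))
    step t = does⇒ (step? _ _) (proj₂ path t)

    flag-sound : ∀ t → fl t ≡ true → ∃[ k ] (k ≤ t × good (π k) ≡ true × ConstantOn π k (suc t))
    flag-sound zero f≡t = 0 , z≤n , trans (cong (good ∘ proj₁) start) (trans (sym (cong proj₂ start)) f≡t)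
                        , constant-here 0
    flag-sound (suc t) f≡t with step t
    ... | _ , inj₂ (_ , _ , f′≡g) = suc t , ≤-refl , trans (sym f′≡g) f≡t , constant-here (suc t)
    ... | _ , inj₁ (same , f′≡f∨g) with ∨-true (fl t) (trans (sym f′≡f∨g) f≡t)
    ...   | inj₂ g = suc t , ≤-refl , g , constant-here (suc t)
    ...   | inj₁ f with flag-sound t f
    ...     | k , k≤t , g , const = k , m≤n⇒m≤1+n k≤t , g , constant-extend const k≤t same

    open Splice π detour

    -- The rest of the current block is a walk inside the r'-class of π t back to π t.
    Inv : State → Set
    Inv (t , c , rest) = SameColor (π t) c × Walk (SameColor (π t)) c rest (π t)

    inv : ∀ p → Inv (state p)
    inv zero    = refl , detourOf-walk (π 0) (good? (π 0))
    inv (suc p) = inv-next (state p) (inv p)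
      where
        inv-next : ∀ s → Inv s → Inv (next s)
        inv-next (t , _ , [])     _                   = refl , detourOf-walk (π (suc t)) (good? (π (suc t)))
        inv-next (t , _ , _ ∷ _)  (_ , cons _ x∈ w) = x∈ , w

    σ-color : ∀ p → Lr' (σ p) ≡ Lr' (π (block p))
    σ-color p = proj₁ (inv p)

    σ-path : IsPath graph σ
    σ-path = cong proj₁ start , λ p → edge (state p) (inv p)
      where
        edge : ∀ s → Inv s → E (proj₁ (proj₂ s)) (proj₁ (proj₂ (next s))) ≡ true
        edge (t , _ , [])    (_ , nil)        = proj₁ (step t)
        edge (t , _ , _ ∷ _) (_ , cons e _ _) = e

    σ-infOften : ∀ B → InfOften B π → InfOften B σ
    σ-infOften B inf k with inf k
    ... | i , k≤i , Bπi with blockStart i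
    ...   | p , eq = p , ≤-trans k≤i (subst (_≤ p) (cong proj₁ eq) (block≤ p))
                   , trans (cong (B ∘ proj₁ ∘ proj₂) eq) Bπi

    leave : ∀ s → Inv s → Lr' (proj₁ (proj₂ (next s))) ≢ Lr' (proj₁ (proj₂ s)) →
            s ≡ (proj₁ s , π (proj₁ s) , [])
    leave (t , _ , [])    (_ , nil)             _      = refl
    leave (t , _ , _ ∷ _) (c∈ , cons _ x∈ _) change = ⊥-elim (change (trans x∈ (sym c∈)))

    exit : ∀ q → ChangePoint G σ (suc q) →
           state q ≡ (block q , π (block q) , []) × fl (block q) ≡ true
    exit q change = exhausted , flagged
      where
        t : ℕ
        t = block q
        exhausted : state q ≡ (t , π t , [])
        exhausted = leave (state q) (inv q) change
        π-change : Lr' (π t) ≢ Lr' (π (suc t))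
        π-change same = change (trans (cong (Lr' ∘ proj₁ ∘ proj₂ ∘ next) exhausted)
                                      (trans (sym same) (cong (Lr' ∘ proj₁ ∘ proj₂) (sym exhausted))))
        flagged : fl t ≡ true
        flagged with step t
        ... | _ , inj₁ (same , _)  = ⊥-elim (π-change same)
        ... | _ , inj₂ (_ , f , _) = f

    returned : ∀ {t c} p → state p ≡ (t , c , []) → σ p ≡ π t
    returned p eq with subst Inv eq (inv p)
    ... | _ , nil = cong (proj₁ ∘ proj₂) eq

    detour-pumps : ∀ k → good (π k) ≡ true →
      ∃[ sk ] ∃[ j′ ] ∃[ j″ ] (block sk ≡ k × sk < j′ × j′ < j″ × block j″ ≡ k
                              × σ sk ≡ σ j″ × Lr (σ sk) ≢ Lr (σ j′))
    detour-pumps k g with blockStart k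
    ... | sk , eq with detourOf-flips (π k) (good? (π k)) g
    ...   | x , x∈ , flip with visit (detour (π k)) eq x∈ | finish (detour (π k)) eq
    ...     | m , m<len , σj′≡x | _ , eq″ =
      sk , suc m + sk , len + sk , cong proj₁ eq , s≤s (m≤n+m sk m) , j′<j″ , cong proj₁ eq″
         , trans σsk≡πk (sym σj″≡πk)
         , λ same → flip (trans (cong Lr (sym σj′≡x)) (trans (sym same) (cong Lr σsk≡πk)))
      where
        len : ℕ
        len = length (detour (π k))
        σsk≡πk : σ sk ≡ π k
        σsk≡πk = cong (proj₁ ∘ proj₂) eq
        σj″≡πk : σ (len + sk) ≡ π k
        σj″≡πk = returned (len + sk) eq″
        j′<j″ : suc m + sk < len + sk
        j′<j″ = ≤∧≢⇒< (+-monoˡ-≤ sk m<len) λ j′≡j″ →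
                  flip (cong Lr (trans (sym σj′≡x) (trans (cong σ j′≡j″) σj″≡πk)))

    σ-constant : ∀ {k sk q} → ConstantOn π k (suc (block q)) → block sk ≡ k →
                 ConstantOn σ sk (suc q)
    σ-constant {sk = sk} {q} const refl p sk≤p p<1+q =
      trans (σ-color p) (trans (const (block p) (block-mono sk≤p) (s≤s (block-mono (≤-pred p<1+q))))
                               (sym (σ-color sk)))

    σ-pumpable : Pumpable G σ
    σ-pumpable i zero (() , _)
    σ-pumpable i (suc q) (i<1+q , cpᵢ , change , _) with exit q change
    ... | exhausted , flagged with flag-sound (block q) flagged
    ...   | k , k≤t , g , const with detour-pumps k g
    ...     | sk , j′ , j″ , bsk , sk<j′ , j′<j″ , bj″ , back , flips =
      sk , j′ , j″ , i≤sk , sk<j′ , j′<j″ , j″<1+q , back , flips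
      where
        -- no change point of σ lies inside (sk , q], so i is at most sk
        i≤sk : i ≤ sk
        i≤sk = ≮⇒≥ λ sk<i → constant⇒noChange (σ-constant const bsk) i sk<i i<1+q cpᵢ
        -- σ is still in block k at j″, but already in block suc t at suc q
        j″<1+q : j″ < suc q
        j″<1+q = ≰⇒> λ 1+q≤j″ → <⇒≱ (s≤s k≤t)
          (subst₂ _≤_ (cong (proj₁ ∘ next) exhausted) bj″ (block-mono 1+q≤j″))

    pumpable : IsAccepting G′ ρ → HasPumpableAcceptingPath G
    pumpable (inf₁ , inf₂) = σ , σ-path , (σ-infOften B₁ inf₁ , σ-infOften B₂ inf₂) , σ-pumpable

  correct : HasPumpableAcceptingPath G ⇔ HasAcceptingPath G′
  correct = mk⇔ (λ (π , path , acc , pump) → PumpableToAccepting.lift π path pump acc)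
                (λ (ρ , path , acc) → AcceptingToPumpable.pumpable ρ path acc)

sum-bound : ∀ {A : Set} (f : A → ℕ) b xs → (∀ x → f x ≤ b) → sum (map f xs) ≤ length xs * b
sum-bound f b []       _     = z≤n
sum-bound f b (x ∷ xs) f≤b = +-mono-≤ (f≤b x) (sum-bound f b xs f≤b)

edgeCount-bound : ∀ m E → edgeCount m E ≤ m * m
edgeCount-bound m E = begin
  edgeCount m E          ≤⟨ sum-bound _ m (allFin m) row≤m ⟩
  length (allFin m) * m  ≡⟨ cong (_* m) (length-tabulate {n = m} id) ⟩
  m * m                  ∎
  where
    open ≤-Reasoning
    indicator≤1 : ∀ b → (if b then 1 else 0) ≤ 1
    indicator≤1 true  = ≤-refl
    indicator≤1 false = z≤n
    row≤m : ∀ u → sum (map (λ v → if E u v then 1 else 0) (allFin m)) ≤ m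
    row≤m u = begin
      sum (map (λ v → if E u v then 1 else 0) (allFin m)) ≤⟨ sum-bound _ 1 (allFin m) (indicator≤1 ∘ E u) ⟩
      length (allFin m) * 1                                ≡⟨ *-identityʳ _ ⟩
      length (allFin m)                                    ≡⟨ length-tabulate {n = m} id ⟩
      m                                                    ∎

doubled-size : ∀ n N → 0 < n → n ≤ N → (n + n) + (n + n) * (n + n) ≤ 8 * N ^ 2
doubled-size n N 0<n n≤N = begin
  (n + n) + (n + n) * (n + n) ≤⟨ +-mono-≤ 2n≤M (*-mono-≤ 2n≤M 2n≤M) ⟩
  M + M * M                   ≤⟨ +-monoˡ-≤ (M * M) (m≤m*n M M {{>-nonZero 0<M}}) ⟩
  M * M + M * M               ≡⟨ square-identity N ⟩
  8 * N ^ 2                   ∎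
  where
    open ≤-Reasoning
    M : ℕ
    M = N + N
    2n≤M : n + n ≤ M
    2n≤M = +-mono-≤ n≤N n≤N
    0<M : 0 < M
    0<M = ≤-trans 0<n (≤-trans n≤N (m≤m+n N N))
    square-identity : ∀ N → (N + N) * (N + N) + (N + N) * (N + N) ≡ 8 * (N * (N * 1))
    square-identity = solve-∀

mainTheorem2 : ∃[ c ] ∀ (G : ColoredBuchiGraph) → ∃[ G' ]
    (size G' ≤ c * csize G ^ 2 × (HasPumpableAcceptingPath G ⇔ HasAcceptingPath G'))
mainTheorem2 = 8 , λ G → let open ColoredBuchiGraph G; open Construction G in
  G′ , ≤-trans (+-monoʳ-≤ (n + n) (edgeCount-bound (n + n) _))
                (doubled-size n (csize G) (≤-<-trans z≤n (Fin.toℕ<n v₀)) (m≤m+n n _))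
     , correct
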